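{- Let $B$ be a decidable predicate on natural numbers such that $\neg\,\forall n.\,\neg B\,n$. Then $\mathit{cofinally}\ 0\models\neg\,\mathit{infinite}$, i.e., no trace satisfies both $\mathit{cofinally}\ 0$ and $\mathit{infinite}$.
   Context: The metatheory is constructive. A state $\sigma$ assigns integers to variables; $\sigma\,x$ is the value of variable $x$. Traces are coinductive: $\langle\sigma\rangle$ is a trace, and $\sigma::\tau$ is a trace if $\tau$ is. Infiniteness is coinductive: $\sigma::\tau$ is infinite if $\tau$ is infinite; $\mathit{infinite}$ is the trace predicate "is infinite". For a fixed variable $x$, the family of trace predicates $\mathit{cofinally}\ n$ ($n\in\mathbb{N}$) is defined coinductively by: $\sigma::\langle\sigma\rangle$ satisfies $\mathit{cofinally}\ n$ if $\sigma\,x=n$ and $B\,n$; $\sigma::\sigma::\tau$ satisfies $\mathit{cofinally}\ n$ if $\sigma\,x=n$, $\neg B\,n$, and $\tau$ satisfies $\mathit{cofinally}\ (n+1)$. $P\models Q$ means every trace satisfying $P$ satisfies $Q$. -}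

module Defs where

open import Data.Nat using (ℕ; suc)
open import Data.Integer using (ℤ; +_)
open import Data.Sum using (_⊎_; inj₁; inj₂)
open import Data.Product using (Σ; _×_; _,_; ∃)
open import Relation.Nullary using (¬_)
open import Relation.Binary.PropositionalEquality using (_≡_)

--  * A (possibly infinite) trace is an element of the final coalgebra of
--      F X = State ⊎ (State × X)
--    where  inj₁ σ  is the trace ⟨σ⟩  and  inj₂ (σ , τ)  is  σ :: τ.
--    A trace is presented as a state x₀ of some coalgebra (X , out).
--  * Coinductive predicates (greatest fixed points) are given by the
--    coinduction principle: a trace satisfies one iff some post-fixed
--    point (invariant) of the defining clauses contains it.

State : Set → Set
State Var = Var → ℤ

module _ {Var : Set} where

  record Trace : Set₁ where
    constructor trace
    field
      Carrier : Set
      out     : Carrier → State Var ⊎ (State Var × Carrier)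
      start   : Carrier

  TPred : Set₂
  TPred = Trace → Set₁

  _⊨_ : TPred → TPred → Set₁
  P ⊨ Q = ∀ τ → P τ → Q τ

  ¬ᵗ_ : TPred → TPred
  (¬ᵗ P) τ = ¬ P τ

  -- infinite: greatest predicate with  σ :: τ infinite  if  τ infinite.
  Infinite : TPred
  Infinite (trace X out x₀) =
    Σ (X → Set) λ I → I x₀ ×
      (∀ y → I y → Σ (State Var) λ σ → Σ X λ y' → (out y ≡ inj₂ (σ , y')) × I y')

  -- cofinally n (for fixed variable x and predicate B): greatest family with
  --   σ :: ⟨σ⟩      ∈ cofinally n  if  σ x = n  and  B n
  --   σ :: σ :: τ   ∈ cofinally n  if  σ x = n, ¬ B n, τ ∈ cofinally (n+1)
  CofinallyStep : (x : Var) (B : ℕ → Set) (X : Set)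
                  (out : X → State Var ⊎ (State Var × X)) →
                  (ℕ → X → Set) → ℕ → X → Set
  CofinallyStep x B X out R n y =
    Σ (State Var) λ σ → Σ X λ y₁ → (out y ≡ inj₂ (σ , y₁)) × (σ x ≡ + n) ×
      ( ((out y₁ ≡ inj₁ σ) × B n)
      ⊎ (¬ B n × Σ X λ y₂ → (out y₁ ≡ inj₂ (σ , y₂)) × R (suc n) y₂) )

  cofinally : (x : Var) (B : ℕ → Set) → ℕ → TPred
  cofinally x B n (trace X out x₀) =
    Σ (ℕ → X → Set) λ R → R n x₀ ×
      (∀ m y → R m y → CofinallyStep x B X out R m y)

module Submission where

-- Since the coalgebra is deterministic,
-- a point lying in both R n and I can never take the terminating clause
-- σ :: ⟨σ⟩, so it must take the clause σ :: σ :: τ, which yields ¬ B n and a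
-- point lying in both R (n + 1) and I.  Iterating this from the start point
-- gives ¬ B k for every k, contradicting the hypothesis on B.

open import Defs
open import Data.Nat using (ℕ; zero; suc; _+_)
open import Data.Nat.Properties using (+-suc; +-identityʳ)
open import Data.Sum using (_⊎_; inj₁; inj₂)
open import Data.Product using (Σ; _×_; _,_)
open import Data.Empty using (⊥-elim)
open import Relation.Nullary using (¬_; Dec)
open import Relation.Binary.PropositionalEquality using (_≡_; _≢_; refl; trans; sym; subst)

module _ {Var : Set} {X : Set} (out : X → State Var ⊎ (State Var × X)) where

  IsInfinityInvariant : (X → Set) → Set
  IsInfinityInvariant I =
    ∀ y → I y → Σ (State Var) λ σ → Σ X λ y' → (out y ≡ inj₂ (σ , y')) × I y'

  module _ {I : X → Set} (invariant : IsInfinityInvariant I) where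

    -- Because  out  is a function, the successor of an invariant point is the
    -- one supplied by the invariant, hence again in I.
    invariant-successor : ∀ {y σ y'} → I y → out y ≡ inj₂ (σ , y') → I y'
    invariant-successor {y} iy step with invariant y iy
    ... | _ , _ , step' , iy' with trans (sym step) step'
    ... | refl = iy'

    invariant-not-final : ∀ {y σ} → I y → out y ≢ inj₁ σ
    invariant-not-final {y} iy final with invariant y iy
    ... | _ , _ , step , _ with trans (sym final) step
    ... | ()

    module _ (x : Var) (B : ℕ → Set) {R : ℕ → X → Set}
             (cofinal : ∀ m y → R m y → CofinallyStep x B X out R m y) where

      cofinally-advance : ∀ {n y} → R n y → I y →
                          ¬ B n × Σ X λ y' → R (suc n) y' × I y'
      cofinally-advance {n} {y} r iy with cofinal n y r
      ... | _ , _ , step₁ , _ , inj₁ (final , _) =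
        ⊥-elim (invariant-not-final (invariant-successor iy step₁) final)
      ... | _ , _ , step₁ , _ , inj₂ (¬b , y₂ , step₂ , r₂) =
        ¬b , y₂ , r₂ , invariant-successor (invariant-successor iy step₁) step₂

      cofinally-never : ∀ {n y} → R n y → I y → ∀ k → ¬ B (n + k)
      cofinally-never {n} r iy k with cofinally-advance r iy
      cofinally-never {n} r iy zero    | ¬b , _ =
        subst (λ m → ¬ B m) (sym (+-identityʳ n)) ¬b
      cofinally-never {n} r iy (suc k) | _ , _ , r' , iy' =
        subst (λ m → ¬ B m) (sym (+-suc n k)) (cofinally-never r' iy' k)

lemma5p1 : {Var : Set} (x : Var) (B : ℕ → Set) → (∀ n → Dec (B n)) →
    ¬ (∀ n → ¬ B n) →
    cofinally x B 0 ⊨ (¬ᵗ Infinite)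
lemma5p1 x B _ somewhere (trace X out x₀) (R , r₀ , cofinal) (I , i₀ , invariant) =
  somewhere (cofinally-never out invariant x B cofinal r₀ i₀)
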